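{- In the setting described in the context, every static priority policy is consistent, and the longest-queue policy (with ties broken according to a fixed order) is consistent.
   Context: Model: $n$ agent types $\mathcal A$, a set $\mathcal M_+$ of allowed matches, each consisting of two distinct types; in each discrete period one agent arrives, of some type; after the arrival, a match can be performed only if each of its types has a waiting agent; $Q_i(t)$ is the number of waiting type-$i$ agents after period $t$. A given set $\mathcal A_+\subseteq\mathcal A$ of types (the under-demanded types) is truncated: an arriving agent of a type in $\mathcal A_+$ that is not matched in its arrival period is discarded; unmatched arriving agents of other types join their queue. Static priority policy: for each type $i$, a subset $\mathcal M(i)$ of allowed matches containing $i$ with a strict order $\succ_i$; on a type-$i$ arrival, perform the $\succ_i$-highest match in $\mathcal M(i)$ whose other type has a non-empty queue, if any. Longest-queue policy: on a type-$i$ arrival, among the types $j$ with $m(i,j)\in\mathcal M_+$ and non-empty queue, match with one having the largest queue length, ties broken by a fixed order; if none, no match. A state is valid under a policy if it is reachable from the all-zero state. A policy is consistent if for all valid initial states $Q(0),Q'(0)$ and every possible arrival at time 1, there is a coupling $\mu$ of the resulting $Q(1)$ and $Q'(1)$ (randomness from the policy) with $\mathbb E_\mu\|Q(1)-Q'(1)\|_1\le\|Q(0)-Q'(0)\|_1$. -}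

module Defs where

open import Data.Nat using (ℕ; zero; suc; _+_; _≤_; _<ᵇ_; ∣_-_∣; pred)
open import Data.Bool using (Bool; true; false; if_then_else_; _∧_)
open import Data.Fin using (Fin; zero; suc; _≟_)
open import Data.Fin.Subset using (Subset; _∈_)
open import Data.Fin.Subset.Properties using (_∈?_)
open import Data.List using (List; []; _∷_)
open import Data.Maybe using (Maybe; just; nothing)
open import Relation.Nullary using (yes; no)

-- Queue-length state: Q i = number of waiting type-i agents.
State : ℕ → Set
State n = Fin n → ℕ

zeroState : ∀ {n} → State n
zeroState _ = 0

sumFin : ∀ {n} → (Fin n → ℕ) → ℕ
sumFin {zero}  f = 0
sumFin {suc n} f = f zero + sumFin (λ i → f (suc i))

dist : ∀ {n} → State n → State n → ℕ
dist Q Q' = sumFin (λ i → ∣ Q i - Q' i ∣)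

update : ∀ {n} → Fin n → (ℕ → ℕ) → State n → State n
update j f Q k with k ≟ j
... | yes _ = f (Q k)
... | no  _ = Q k

-- A (deterministic) policy: on a type-i arrival in state Q, the type of the
-- waiting agent it is matched with (nothing = no match).
Policy : ℕ → Set
Policy n = Fin n → State n → Maybe (Fin n)

-- One period: arrival of a type-i agent.  A matched waiting type-j agent leaves;
-- an unmatched arrival of a truncated type (in A₊) is discarded, otherwise joins
-- its queue.
step : ∀ {n} → Subset n → Policy n → Fin n → State n → State n
step A₊ π i Q with π i Q
... | just j  = update j pred Q
... | nothing with i ∈? A₊
...   | yes _ = Q
...   | no  _ = update i suc Q

data Valid {n} (A₊ : Subset n) (π : Policy n) : State n → Set where
  valid-zero : Valid A₊ π zeroState
  valid-step : ∀ {Q} (i : Fin n) → Valid A₊ π Q → Valid A₊ π (step A₊ π i Q)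

-- Consistency (for a deterministic policy the only coupling is the product of
-- point masses, so the expected ℓ¹ distance is the plain distance).
Consistent : ∀ {n} → Subset n → Policy n → Set
Consistent A₊ π = ∀ Q Q' → Valid A₊ π Q → Valid A₊ π Q' → ∀ i →
  dist (step A₊ π i Q) (step A₊ π i Q') ≤ dist Q Q'

-- Static priority: prio i lists the partner types of M(i) from ≻ᵢ-highest
-- down; pick the first one with a non-empty queue.
firstNonEmpty : ∀ {n} → State n → List (Fin n) → Maybe (Fin n)
firstNonEmpty Q [] = nothing
firstNonEmpty Q (j ∷ js) = if 0 <ᵇ Q j then just j else firstNonEmpty Q js

staticPriority : ∀ {n} → (Fin n → List (Fin n)) → Policy n
staticPriority prio i Q = firstNonEmpty Q (prio i)

-- Longest queue: among allowed partners j (Adj i j) with Q j > 0, one with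
-- largest Q j; ties broken by position in the fixed order list `tie`
-- (earlier = preferred).
longestAmong : ∀ {n} → State n → (Fin n → Bool) → List (Fin n) → Maybe (Fin n)
longestAmong Q ok [] = nothing
longestAmong Q ok (j ∷ js) with longestAmong Q ok js
... | nothing = if ok j ∧ (0 <ᵇ Q j) then just j else nothing
... | just k  = if ok j ∧ (0 <ᵇ Q j) then (if Q j <ᵇ Q k then just k else just j) else just k

longestQueue : ∀ {n} → (Fin n → Fin n → Bool) → List (Fin n) → Policy n
longestQueue Adj tie i Q = longestAmong Q (Adj i) tie

{-# OPTIONS --safe #-}
-- In one period each run changes its queue vector in at most one coordinate, by one unit,
-- so it suffices to compare what the two runs do with the same arrival i. Both policies are
-- admissible: a chosen partner j ≠ i has a waiting agent; if one run matches i with j and the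
-- other does not match, j's queue is empty in the other run; and if the runs choose different
-- partners j ≠ j', then j's queue is strictly longer in the first run or j''s in the second
-- (for static priority one of the two is empty; for longest queue the choice could not change
-- otherwise). In every case where the runs differ, one of them decrements a coordinate on
-- which it is ahead, gaining one unit of ℓ¹ distance, which pays for the at most one unit lost
-- at the other coordinate that changes.
module Submission where

open import Defs
open import Data.Nat using (ℕ; zero; suc; _+_; _≤_; _<_; pred; ∣_-_∣; _<ᵇ_; z≤n; s≤s; z<s)
open import Data.Nat.Properties hiding (_≟_)
open import Algebra.Properties.CommutativeSemigroup +-commutativeSemigroup using (x∙yz≈y∙xz)
open import Data.Bool using (Bool; true; false)
open import Data.Fin using (Fin; zero; suc; _≟_)
open import Data.Fin.Subset using (Subset)
open import Data.Fin.Subset.Properties using (_∈?_)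
open import Data.List using (List; _∷_)
open import Data.List.Relation.Unary.All using (All; lookup)
open import Data.List.Relation.Unary.Any using (here; there)
open import Data.List.Relation.Unary.Unique.Propositional using (Unique)
open import Data.List.Membership.Propositional using (_∈_)
open import Data.Maybe using (just; nothing)
open import Data.Maybe.Properties using (just-injective)
open import Data.Product using (_×_; _,_; proj₁; proj₂; map₁)
open import Data.Sum using (_⊎_; inj₁; inj₂)
open import Data.Empty using (⊥; ⊥-elim)
open import Function using (_∘_; case_of_)
open import Relation.Nullary using (yes; no; ¬_; contradiction)
open import Relation.Nullary.Reflects using (ofʸ; ofⁿ)
open import Relation.Binary.PropositionalEquality using (_≡_; _≢_; refl; sym; trans; cong; subst)

∣pred[m]-pred[n]∣≤∣m-n∣ : ∀ m n → ∣ pred m - pred n ∣ ≤ ∣ m - n ∣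
∣pred[m]-pred[n]∣≤∣m-n∣ zero    zero    = ≤-refl
∣pred[m]-pred[n]∣≤∣m-n∣ zero    (suc n) = n≤1+n n
∣pred[m]-pred[n]∣≤∣m-n∣ (suc m) zero    = ≤-trans (≤-reflexive (∣-∣-identityʳ m)) (n≤1+n m)
∣pred[m]-pred[n]∣≤∣m-n∣ (suc m) (suc n) = ≤-refl

n<m⇒1+∣pred[m]-n∣≡∣m-n∣ : ∀ m n → n < m → suc ∣ pred m - n ∣ ≡ ∣ m - n ∣
n<m⇒1+∣pred[m]-n∣≡∣m-n∣ (suc m)       zero    _         = cong suc (∣-∣-identityʳ m)
n<m⇒1+∣pred[m]-n∣≡∣m-n∣ (suc (suc m)) (suc n) (s≤s n<m) = n<m⇒1+∣pred[m]-n∣≡∣m-n∣ (suc m) n n<m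

∣n-pred[n]∣≤1 : ∀ n → ∣ n - pred n ∣ ≤ 1
∣n-pred[n]∣≤1 zero          = z≤n
∣n-pred[n]∣≤1 (suc zero)    = ≤-refl
∣n-pred[n]∣≤1 (suc (suc n)) = ∣n-pred[n]∣≤1 (suc n)

∣n-1+n∣≤1 : ∀ n → ∣ n - suc n ∣ ≤ 1
∣n-1+n∣≤1 zero    = ≤-refl
∣n-1+n∣≤1 (suc n) = ∣n-1+n∣≤1 n

∣n-o∣≤1⇒∣m-o∣≤1+∣m-n∣ : ∀ m n o → ∣ n - o ∣ ≤ 1 → ∣ m - o ∣ ≤ suc ∣ m - n ∣
∣n-o∣≤1⇒∣m-o∣≤1+∣m-n∣ m n o ∣n-o∣≤1 = begin
  ∣ m - o ∣             ≤⟨ ∣-∣-triangle m n o ⟩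
  ∣ m - n ∣ + ∣ n - o ∣ ≤⟨ +-monoʳ-≤ ∣ m - n ∣ ∣n-o∣≤1 ⟩
  ∣ m - n ∣ + 1         ≡⟨ +-comm ∣ m - n ∣ 1 ⟩
  suc ∣ m - n ∣         ∎
  where open ≤-Reasoning

sumFin-mono : ∀ {n} {f g : Fin n → ℕ} → (∀ m → f m ≤ g m) → sumFin f ≤ sumFin g
sumFin-mono {zero}  f≤g = z≤n
sumFin-mono {suc n} f≤g = +-mono-≤ (f≤g zero) (sumFin-mono (λ m → f≤g (suc m)))

sumFin-mono-except : ∀ {n} {f g : Fin n → ℕ} (k : Fin n) {a b : ℕ} →
  (∀ m → m ≢ k → f m ≤ g m) → a + f k ≤ b + g k → a + sumFin f ≤ b + sumFin g
sumFin-mono-except {suc n} {f} {g} zero {a} {b} f≤g ak≤bk = begin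
  a + (f zero + sumFin (λ m → f (suc m))) ≡⟨ +-assoc a (f zero) _ ⟨
  a + f zero + sumFin (λ m → f (suc m))   ≤⟨ +-mono-≤ ak≤bk (sumFin-mono (λ m → f≤g (suc m) λ ())) ⟩
  b + g zero + sumFin (λ m → g (suc m))   ≡⟨ +-assoc b (g zero) _ ⟩
  b + (g zero + sumFin (λ m → g (suc m))) ∎
  where open ≤-Reasoning
sumFin-mono-except {suc n} {f} {g} (suc k) {a} {b} f≤g ak≤bk = begin
  a + (f zero + sumFin (λ m → f (suc m))) ≡⟨ x∙yz≈y∙xz a (f zero) _ ⟩
  f zero + (a + sumFin (λ m → f (suc m))) ≤⟨ +-mono-≤ (f≤g zero λ ()) tail≤ ⟩
  g zero + (b + sumFin (λ m → g (suc m))) ≡⟨ x∙yz≈y∙xz (g zero) b _ ⟩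
  b + (g zero + sumFin (λ m → g (suc m))) ∎
  where
  open ≤-Reasoning
  tail≤ : a + sumFin (λ m → f (suc m)) ≤ b + sumFin (λ m → g (suc m))
  tail≤ = sumFin-mono-except k (λ m m≢k → f≤g (suc m) (λ { refl → m≢k refl })) ak≤bk

dist-comm-≤ : ∀ {n} (Q Q' : State n) → dist Q Q' ≤ dist Q' Q
dist-comm-≤ Q Q' = sumFin-mono (λ m → ≤-reflexive (∣-∣-comm (Q m) (Q' m)))

dist-swap : ∀ {n} (P P' Q Q' : State n) → dist P' P ≤ dist Q' Q → dist P P' ≤ dist Q Q'
dist-swap P P' Q Q' d≤d = ≤-trans (dist-comm-≤ P P') (≤-trans d≤d (dist-comm-≤ Q' Q))

update-same : ∀ {n} (k : Fin n) (f : ℕ → ℕ) (Q : State n) → update k f Q k ≡ f (Q k)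
update-same k f Q with k ≟ k
... | yes _   = refl
... | no k≢k = contradiction refl k≢k

update-other : ∀ {n} {k m : Fin n} (f : ℕ → ℕ) (Q : State n) → m ≢ k → update k f Q m ≡ Q m
update-other {k = k} {m} f Q m≢k with m ≟ k
... | yes m≡k = contradiction m≡k m≢k
... | no _    = refl

dist-update : ∀ {n} (k : Fin n) {f : ℕ → ℕ} → (∀ x y → ∣ f x - f y ∣ ≤ ∣ x - y ∣) →
  (Q Q' : State n) → dist (update k f Q) (update k f Q') ≤ dist Q Q'
dist-update k {f} f-nonexp Q Q' = sumFin-mono-except k {0} {0} off-k at-k
  where
  off-k : ∀ m → m ≢ k → ∣ update k f Q m - update k f Q' m ∣ ≤ ∣ Q m - Q' m ∣
  off-k m m≢k rewrite update-other f Q m≢k | update-other f Q' m≢k = ≤-refl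
  at-k : ∣ update k f Q k - update k f Q' k ∣ ≤ ∣ Q k - Q' k ∣
  at-k rewrite update-same k f Q | update-same k f Q' = f-nonexp (Q k) (Q' k)

dist-pred-toward : ∀ {n} {j k : Fin n} {Q Q' R : State n} → j ≢ k → Q' j < Q j →
  (∀ m → m ≢ k → R m ≡ Q' m) → ∣ Q' k - R k ∣ ≤ 1 → dist (update j pred Q) R ≤ dist Q Q'
dist-pred-toward {j = j} {k} {Q} {Q'} {R} j≢k Q'j<Qj R≡Q' ∣Q'k-Rk∣≤1 =
  ≤-trans perturb-k gain-j
  where
  P : State _
  P = update j pred Q
  gain-j : 1 + dist P Q' ≤ 0 + dist Q Q'
  gain-j = sumFin-mono-except j
    (λ m m≢j → ≤-reflexive (cong (λ x → ∣ x - Q' m ∣) (update-other pred Q m≢j)))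
    (≤-reflexive (trans (cong (λ x → suc ∣ x - Q' j ∣) (update-same j pred Q))
                        (n<m⇒1+∣pred[m]-n∣≡∣m-n∣ (Q j) (Q' j) Q'j<Qj)))
  perturb-k : 0 + dist P R ≤ 1 + dist P Q'
  perturb-k = sumFin-mono-except k
    (λ m m≢k → ≤-reflexive (cong (λ x → ∣ P m - x ∣) (R≡Q' m m≢k)))
    (subst (λ x → ∣ x - R k ∣ ≤ suc ∣ x - Q' k ∣) (sym (update-other pred Q (j≢k ∘ sym)))
      (∣n-o∣≤1⇒∣m-o∣≤1+∣m-n∣ (Q k) (Q' k) (R k) ∣Q'k-Rk∣≤1))

arrive : ∀ {n} → Subset n → Fin n → State n → State n
arrive A₊ i Q with i ∈? A₊
... | yes _ = Q
... | no  _ = update i suc Q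

arrive-other : ∀ {n} (A₊ : Subset n) {i m : Fin n} (Q : State n) → m ≢ i → arrive A₊ i Q m ≡ Q m
arrive-other A₊ {i} Q m≢i with i ∈? A₊
... | yes _ = refl
... | no  _ = update-other suc Q m≢i

∣Q-arrive∣≤1 : ∀ {n} (A₊ : Subset n) (i : Fin n) (Q : State n) → ∣ Q i - arrive A₊ i Q i ∣ ≤ 1
∣Q-arrive∣≤1 A₊ i Q with i ∈? A₊
... | yes _ = subst (_≤ 1) (sym (∣n-n∣≡0 (Q i))) z≤n
... | no  _ rewrite update-same i suc Q = ∣n-1+n∣≤1 (Q i)

dist-arrive : ∀ {n} (A₊ : Subset n) (i : Fin n) (Q Q' : State n) →
  dist (arrive A₊ i Q) (arrive A₊ i Q') ≤ dist Q Q'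
dist-arrive A₊ i Q Q' with i ∈? A₊
... | yes _ = ≤-refl
... | no  _ = dist-update i (λ _ _ → ≤-refl) Q Q'

module _ {n} (A₊ : Subset n) (π : Policy n) {i : Fin n} {Q : State n} where

  step-matched : ∀ {j} → π i Q ≡ just j → step A₊ π i Q ≡ update j pred Q
  step-matched π≡j rewrite π≡j = refl

  step-unmatched : π i Q ≡ nothing → step A₊ π i Q ≡ arrive A₊ i Q
  step-unmatched π≡nothing rewrite π≡nothing with i ∈? A₊
  ... | yes _ = refl
  ... | no  _ = refl

record Admissible {n} (π : Policy n) : Set where
  field
    partner-waiting : ∀ {i Q j} → π i Q ≡ just j → 0 < Q j
    partner-other   : ∀ {i Q j} → π i Q ≡ just j → j ≢ i
    unmatched⇒partner-empty : ∀ {i Q Q' j} → π i Q ≡ just j → π i Q' ≡ nothing → Q' j ≡ 0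
    switch⇒strict : ∀ {i Q Q' j j'} → π i Q ≡ just j → π i Q' ≡ just j' → j ≢ j' →
      Q' j < Q j ⊎ Q j' < Q' j'

module _ {n} (A₊ : Subset n) {π : Policy n} (admissible : Admissible π) where
  open Admissible admissible

  private
    matched-vs-unmatched : ∀ {i Q Q' j} → π i Q ≡ just j → π i Q' ≡ nothing →
      dist (update j pred Q) (arrive A₊ i Q') ≤ dist Q Q'
    matched-vs-unmatched {i} {Q} {Q'} π≡j π'≡nothing =
      dist-pred-toward (partner-other π≡j)
        (subst (_< Q _) (sym (unmatched⇒partner-empty π≡j π'≡nothing)) (partner-waiting π≡j))
        (λ m → arrive-other A₊ Q') (∣Q-arrive∣≤1 A₊ i Q')

    matched-vs-matched : ∀ (Q Q' : State n) {j j'} → j ≢ j' → Q' j < Q j →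
      dist (update j pred Q) (update j' pred Q') ≤ dist Q Q'
    matched-vs-matched Q Q' {j' = j'} j≢j' Q'j<Qj =
      dist-pred-toward j≢j' Q'j<Qj (λ m → update-other pred Q')
        (subst (λ x → ∣ Q' j' - x ∣ ≤ 1) (sym (update-same j' pred Q')) (∣n-pred[n]∣≤1 (Q' j')))

  step-nonexpansive : ∀ i Q Q' → dist (step A₊ π i Q) (step A₊ π i Q') ≤ dist Q Q'
  step-nonexpansive i Q Q' = by-choices (π i Q) (π i Q') refl refl
    where
    by-choices : ∀ c c' → π i Q ≡ c → π i Q' ≡ c' →
      dist (step A₊ π i Q) (step A₊ π i Q') ≤ dist Q Q'
    by-choices (just j) (just j') π≡ π'≡
      rewrite step-matched A₊ π π≡ | step-matched A₊ π π'≡ with j ≟ j'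
    ... | yes refl = dist-update j ∣pred[m]-pred[n]∣≤∣m-n∣ Q Q'
    ... | no j≢j' with switch⇒strict π≡ π'≡ j≢j'
    ...   | inj₁ Q'j<Qj   = matched-vs-matched Q Q' j≢j' Q'j<Qj
    ...   | inj₂ Qj'<Q'j' = dist-swap (update j pred Q) (update j' pred Q') Q Q'
                                (matched-vs-matched Q' Q (j≢j' ∘ sym) Qj'<Q'j')
    by-choices (just j) nothing π≡ π'≡
      rewrite step-matched A₊ π π≡ | step-unmatched A₊ π π'≡ = matched-vs-unmatched π≡ π'≡
    by-choices nothing (just j) π≡ π'≡
      rewrite step-unmatched A₊ π π≡ | step-matched A₊ π π'≡ =
        dist-swap (arrive A₊ i Q) (update j pred Q') Q Q' (matched-vs-unmatched π'≡ π≡)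
    by-choices nothing nothing π≡ π'≡
      rewrite step-unmatched A₊ π π≡ | step-unmatched A₊ π π'≡ = dist-arrive A₊ i Q Q'

  admissible⇒consistent : Consistent A₊ π
  admissible⇒consistent Q Q' _ _ i = step-nonexpansive i Q Q'

adjacent⇒≢ : ∀ {n} {Adj : Fin n → Fin n → Bool} → (∀ i → Adj i i ≡ false) →
  ∀ {i j} → Adj i j ≡ true → j ≢ i
adjacent⇒≢ irreflexive {i} adj refl with () ← trans (sym (irreflexive i)) adj

module _ {n : ℕ} where

  firstNonEmpty-just : ∀ (Q : State n) l {j} → firstNonEmpty Q l ≡ just j → j ∈ l × 0 < Q j
  firstNonEmpty-just Q (h ∷ js) found with Q h in Qh≡
  ... | zero = map₁ there (firstNonEmpty-just Q js found)
  ... | suc _ with refl ← found = here refl , subst (0 <_) (sym Qh≡) z<s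

  firstNonEmpty-nothing : ∀ (Q : State n) l {j} → firstNonEmpty Q l ≡ nothing → j ∈ l → Q j ≡ 0
  firstNonEmpty-nothing Q (h ∷ js) none j∈l with Q h in Qh≡ | j∈l
  ... | zero | here refl  = Qh≡
  ... | zero | there j∈js = firstNonEmpty-nothing Q js none j∈js

  firstNonEmpty-switch : ∀ (Q Q' : State n) l {j j'} →
    firstNonEmpty Q l ≡ just j → firstNonEmpty Q' l ≡ just j' → j ≢ j' → Q' j ≡ 0 ⊎ Q j' ≡ 0
  firstNonEmpty-switch Q Q' (h ∷ js) found found' j≢j' with Q h in Qh≡ | Q' h in Q'h≡
  ... | zero  | zero  = firstNonEmpty-switch Q Q' js found found' j≢j'
  ... | zero  | suc _ with refl ← found' = inj₂ Qh≡
  ... | suc _ | zero  with refl ← found  = inj₁ Q'h≡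
  ... | suc _ | suc _ with refl ← found | refl ← found' = contradiction refl j≢j'

staticPriority-admissible : ∀ {n} {Adj : Fin n → Fin n → Bool} → (∀ i → Adj i i ≡ false) →
  (prio : Fin n → List (Fin n)) → (∀ i → All (λ j → Adj i j ≡ true) (prio i)) →
  Admissible (staticPriority prio)
staticPriority-admissible irreflexive prio adjacent = record
  { partner-waiting = λ {i} {Q} found → proj₂ (firstNonEmpty-just Q (prio i) found)
  ; partner-other   = λ {i} {Q} found → adjacent⇒≢ irreflexive
      (lookup (adjacent i) (proj₁ (firstNonEmpty-just Q (prio i) found)))
  ; unmatched⇒partner-empty = λ {i} {Q} {Q'} found none →
      firstNonEmpty-nothing Q' (prio i) none (proj₁ (firstNonEmpty-just Q (prio i) found))
  ; switch⇒strict = switch⇒strict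
  }
  where
  switch⇒strict : ∀ {i Q Q' j j'} → staticPriority prio i Q ≡ just j →
    staticPriority prio i Q' ≡ just j' → j ≢ j' → Q' j < Q j ⊎ Q j' < Q' j'
  switch⇒strict {i} {Q} {Q'} found found' j≢j'
    with firstNonEmpty-switch Q Q' (prio i) found found' j≢j'
  ... | inj₁ Q'j≡0 =
    inj₁ (subst (_< Q _) (sym Q'j≡0) (proj₂ (firstNonEmpty-just Q (prio i) found)))
  ... | inj₂ Qj'≡0 =
    inj₂ (subst (_< Q' _) (sym Qj'≡0) (proj₂ (firstNonEmpty-just Q' (prio i) found')))

module LongestAmong {n : ℕ} (ok : Fin n → Bool) where

  Eligible : State n → Fin n → Set
  Eligible Q k = ok k ≡ true × 0 < Q k

  data Pick (Q : State n) (h : Fin n) (js : List (Fin n)) : Fin n → Set where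
    pick-head : Eligible Q h → (∀ {k} → longestAmong Q ok js ≡ just k → Q k ≤ Q h) →
                Pick Q h js h
    pick-tail : ∀ {k} → longestAmong Q ok js ≡ just k → (Eligible Q h → Q h < Q k) →
                Pick Q h js k

  pick : ∀ Q h js {j} → longestAmong Q ok (h ∷ js) ≡ just j → Pick Q h js j
  pick Q h js with longestAmong Q ok js in tail≡
  ... | nothing with ok h in ok-h | 0 <ᵇ Q h | <ᵇ-reflects-< 0 (Q h)
  ...   | false | _     | _        = λ ()
  ...   | true  | false | _        = λ ()
  ...   | true  | true  | ofʸ 0<Qh = λ { refl →
    pick-head (ok-h , 0<Qh) (λ tail≡' → case trans (sym tail≡) tail≡' of λ ()) }
  pick Q h js | just k with ok h in ok-h | 0 <ᵇ Q h | <ᵇ-reflects-< 0 (Q h)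
  ...   | false | _     | _         = λ { refl →
    pick-tail tail≡ (λ (ok-h' , _) → case trans (sym ok-h) ok-h' of λ ()) }
  ...   | true  | false | ofⁿ 0≮Qh = λ { refl →
    pick-tail tail≡ (λ (_ , 0<Qh) → contradiction 0<Qh 0≮Qh) }
  ...   | true  | true  | ofʸ 0<Qh with Q h <ᵇ Q k | <ᵇ-reflects-< (Q h) (Q k)
  ...     | true  | ofʸ Qh<Qk = λ { refl → pick-tail tail≡ (λ _ → Qh<Qk) }
  ...     | false | ofⁿ Qh≮Qk = λ { refl →
    pick-head (ok-h , 0<Qh) (λ tail≡' →
      subst (λ k' → Q k' ≤ Q h) (just-injective (trans (sym tail≡) tail≡')) (≮⇒≥ Qh≮Qk)) }

  longestAmong-just : ∀ Q l {j} → longestAmong Q ok l ≡ just j → j ∈ l × Eligible Q j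
  longestAmong-just Q (h ∷ js) found with pick Q h js found
  ... | pick-head eligible _ = here refl , eligible
  ... | pick-tail tail≡ _    = map₁ there (longestAmong-just Q js tail≡)

  longestAmong-nothing : ∀ Q l {k} → longestAmong Q ok l ≡ nothing → k ∈ l → ¬ Eligible Q k
  longestAmong-nothing Q (h ∷ js) with longestAmong Q ok js in tail≡
  ... | just k with ok h | 0 <ᵇ Q h
  ...   | false | _    = λ ()
  ...   | true | false = λ ()
  ...   | true | true with Q h <ᵇ Q k
  ...     | true  = λ ()
  ...     | false = λ ()
  longestAmong-nothing Q (h ∷ js) | nothing with ok h in ok-h | 0 <ᵇ Q h | <ᵇ-reflects-< 0 (Q h)
  ... | true  | true  | _ = λ ()
  ... | true  | false | ofⁿ 0≮Qh = λ { refl (here refl) (_ , 0<Qh) → 0≮Qh 0<Qh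
                                     ; refl (there k∈js) → longestAmong-nothing Q js tail≡ k∈js }
  ... | false | _     | _        =
    λ { refl (here refl) (ok-h' , _) → case trans (sym ok-h) ok-h' of λ ()
      ; refl (there k∈js) → longestAmong-nothing Q js tail≡ k∈js }

  longestAmong-max : ∀ Q l {j k} → longestAmong Q ok l ≡ just j → k ∈ l → Eligible Q k → Q k ≤ Q j
  dominates-tail : ∀ Q js {h k} → (∀ {k'} → longestAmong Q ok js ≡ just k' → Q k' ≤ Q h) →
    k ∈ js → Eligible Q k → Q k ≤ Q h

  longestAmong-max Q (h ∷ js) found k∈l eligible with pick Q h js found | k∈l
  ... | pick-head _ _         | here refl   = ≤-refl
  ... | pick-head _ dominates | there k∈js  = dominates-tail Q js dominates k∈js eligible
  ... | pick-tail _ beats     | here refl   = <⇒≤ (beats eligible)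
  ... | pick-tail tail≡ _     | there k∈js  = longestAmong-max Q js tail≡ k∈js eligible

  dominates-tail Q js dominates k∈js eligible with longestAmong Q ok js in tail≡
  ... | nothing = contradiction eligible (longestAmong-nothing Q js tail≡ k∈js)
  ... | just k' = ≤-trans (longestAmong-max Q js tail≡ k∈js eligible) (dominates refl)

  private
    head-vs-tail : ∀ {Q Q'} js {h j'} → Eligible Q h →
      (∀ {k} → longestAmong Q ok js ≡ just k → Q k ≤ Q h) →
      longestAmong Q' ok js ≡ just j' → (Eligible Q' h → Q' h < Q' j') →
      Q h ≤ Q' h → Q' j' ≤ Q j' → ⊥
    head-vs-tail {Q} {Q'} js {h} {j'} (ok-h , 0<Qh) dominates tail≡' beats' Qh≤Q'h Q'j'≤Qj'
      with longestAmong-just Q' js tail≡'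
    ... | j'∈js , ok-j' , 0<Q'j' = <-irrefl refl (begin-strict
      Q h   ≤⟨ Qh≤Q'h ⟩
      Q' h  <⟨ beats' (ok-h , <-≤-trans 0<Qh Qh≤Q'h) ⟩
      Q' j' ≤⟨ Q'j'≤Qj' ⟩
      Q j'  ≤⟨ dominates-tail Q js dominates j'∈js (ok-j' , <-≤-trans 0<Q'j' Q'j'≤Qj') ⟩
      Q h   ∎)
      where open ≤-Reasoning

  longestAmong-stable : ∀ Q Q' l {j j'} →
    longestAmong Q ok l ≡ just j → longestAmong Q' ok l ≡ just j' →
    Q j ≤ Q' j → Q' j' ≤ Q j' → j ≡ j'
  longestAmong-stable Q Q' (h ∷ js) found found' Qj≤Q'j Q'j'≤Qj'
    with pick Q h js found | pick Q' h js found'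
  ... | pick-head _ _ | pick-head _ _ = refl
  ... | pick-tail tail≡ _ | pick-tail tail≡' _ =
    longestAmong-stable Q Q' js tail≡ tail≡' Qj≤Q'j Q'j'≤Qj'
  ... | pick-head eligible dominates | pick-tail tail≡' beats' =
    ⊥-elim (head-vs-tail js eligible dominates tail≡' beats' Qj≤Q'j Q'j'≤Qj')
  ... | pick-tail tail≡ beats | pick-head eligible' dominates' =
    ⊥-elim (head-vs-tail js eligible' dominates' tail≡ beats Q'j'≤Qj' Qj≤Q'j)

longestQueue-admissible : ∀ {n} {Adj : Fin n → Fin n → Bool} → (∀ i → Adj i i ≡ false) →
  (tie : List (Fin n)) → Admissible (longestQueue Adj tie)
longestQueue-admissible {n} {Adj} irreflexive tie = record
  { partner-waiting = λ {i} {Q} found → proj₂ (proj₂ (L.longestAmong-just i Q tie found))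
  ; partner-other   = λ {i} {Q} found →
      adjacent⇒≢ irreflexive (proj₁ (proj₂ (L.longestAmong-just i Q tie found)))
  ; unmatched⇒partner-empty = unmatched⇒partner-empty
  ; switch⇒strict = switch⇒strict
  }
  where
  module L (i : Fin n) = LongestAmong (Adj i)

  unmatched⇒partner-empty : ∀ {i Q Q' j} → longestQueue Adj tie i Q ≡ just j →
    longestQueue Adj tie i Q' ≡ nothing → Q' j ≡ 0
  unmatched⇒partner-empty {i} {Q} {Q'} found none with L.longestAmong-just i Q tie found
  ... | j∈tie , ok-j , _ = n≤0⇒n≡0 (≮⇒≥ λ 0<Q'j →
    L.longestAmong-nothing i Q' tie none j∈tie (ok-j , 0<Q'j))

  switch⇒strict : ∀ {i Q Q' j j'} → longestQueue Adj tie i Q ≡ just j →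
    longestQueue Adj tie i Q' ≡ just j' → j ≢ j' → Q' j < Q j ⊎ Q j' < Q' j'
  switch⇒strict {i} {Q} {Q'} {j} {j'} found found' j≢j' with Q' j <? Q j | Q j' <? Q' j'
  ... | yes Q'j<Qj | _            = inj₁ Q'j<Qj
  ... | no _       | yes Qj'<Q'j' = inj₂ Qj'<Q'j'
  ... | no Q'j≮Qj  | no Qj'≮Q'j'  = contradiction
    (L.longestAmong-stable i Q Q' tie found found' (≮⇒≥ Q'j≮Qj) (≮⇒≥ Qj'≮Q'j')) j≢j'

mainTheorem9 : (n : ℕ) (Adj : Fin n → Fin n → Bool)
    → (∀ i j → Adj i j ≡ Adj j i) → (∀ i → Adj i i ≡ false)
    → (A₊ : Subset n)
    → ((prio : Fin n → List (Fin n))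
        → (∀ i → All (λ j → Adj i j ≡ true) (prio i))
        → (∀ i → Unique (prio i))
        → Consistent A₊ (staticPriority prio))
      × ((tie : List (Fin n)) → Unique tie → (∀ i → i ∈ tie)
        → Consistent A₊ (longestQueue Adj tie))
mainTheorem9 _ _ _ irreflexive A₊ =
    (λ prio adjacent _ →
       admissible⇒consistent A₊ (staticPriority-admissible irreflexive prio adjacent))
  , (λ tie _ _ → admissible⇒consistent A₊ (longestQueue-admissible irreflexive tie))
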